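{- Let $\mathbb{K}\in\{\mathbb{R},\mathbb{C}\}$, let $V$ be a finite-dimensional $\mathbb{K}$-vector space, let $r\ge 1$, and let $e\in\mathbb{K}[\mathcal{S}_r]$ be an idempotent. Then a tensor $T\in\mathcal{T}_rV$ fulfils $eT=T$ if and only if $T_b\in\mathfrak{l}:=\mathbb{K}[\mathcal{S}_r]\cdot e^{\ast}$ for all $b\in V^r$, i.e. all $T_b$ of $T$ lie in the left ideal generated by $e^{\ast}$.
   Context: $\mathcal{T}_rV$ denotes the space of $r$-times covariant tensors on $V$, i.e. multilinear maps $V^r\to\mathbb{K}$. $\mathcal{S}_r$ is the symmetric group on $\{1,\dots,r\}$ with product $(p\circ q)(i)=p(q(i))$, and $\mathbb{K}[\mathcal{S}_r]$ its group ring. An element $a=\sum_{p\in\mathcal{S}_r}a(p)\,p\in\mathbb{K}[\mathcal{S}_r]$ acts on tensors by $(aT)(v_1,\dots,v_r):=\sum_{p}a(p)\,T(v_{p(1)},\dots,v_{p(r)})$. The map $\ast$ is defined by $a^{\ast}:=\sum_p a(p)\,p^{ -1}$. For $T\in\mathcal{T}_rV$ and $b=(v_1,\dots,v_r)\in V^r$ (vectors may be linearly dependent or repeated), $T_b:=\sum_{p\in\mathcal{S}_r}T(v_{p(1)},\dots,v_{p(r)})\,p\in\mathbb{K}[\mathcal{S}_r]$. -}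

module Defs where

open import Level using (Level; _⊔_)
open import Algebra.Bundles using (CommutativeRing)
import Algebra.Definitions.RawMonoid as RawMonoidDefs
open import Data.Nat using (ℕ; zero; suc)
open import Data.Fin using (Fin; zero; suc; _≟_)
open import Data.Vec using (Vec; []; _∷_; lookup; tabulate; allFin)
open import Data.List using (List; []; _∷_; _++_; concatMap; filter; map; foldr)
open import Data.Bool using (Bool; true; false; if_then_else_)
open import Data.Maybe using (Maybe; just; nothing; fromMaybe)
import Data.Maybe
import Data.Vec
open import Relation.Nullary.Decidable using (⌊_⌋)
open import Data.List.Relation.Unary.All using (All)
open import Data.Product using (Σ; ∃; _,_)
open import Relation.Nullary using (¬_; Dec; yes; no)
open import Relation.Nullary.Decidable using (¬?)
open import Relation.Binary.PropositionalEquality using (_≡_; _≢_)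
import Data.Vec.Properties as VecP
import Data.Vec.Relation.Unary.Unique.Propositional as UniqueV
open import Data.Vec.Relation.Unary.AllPairs using () renaming (allPairs? to vecAllPairs?)

-- The standard library has no real or complex
-- numbers, so 𝕂 is an abstract field of characteristic 0 (ℝ and ℂ are
-- such fields).

record IsCharZeroField {c ℓ : Level} (K : CommutativeRing c ℓ) : Set (c ⊔ ℓ) where
  open CommutativeRing K
  field
    0≉1      : ¬ (0# ≈ 1#)
    inverse  : ∀ x → ¬ (x ≈ 0#) → Σ Carrier λ y → (x * y) ≈ 1#
    charZero : ∀ (m : ℕ) → ¬ (RawMonoidDefs._×_ (CommutativeRing.+-rawMonoid K) (suc m) 1# ≈ 0#)

-- Permutations of {1,…,r}, encoded as their value tables
-- p ↦ (p(1),…,p(r)) : Vec (Fin r) r with pairwise distinct entries.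

Word : ℕ → Set
Word r = Vec (Fin r) r

IsPerm : ∀ {r} → Word r → Set
IsPerm = UniqueV.Unique

words : ∀ (r k : ℕ) → List (Vec (Fin r) k)
words r zero    = [] ∷ []
words r (suc k) = concatMap (λ w → map (λ i → i ∷ w) (Data.Vec.toList (allFin r))) (words r k)

isPerm? : ∀ {r} (p : Word r) → Dec (IsPerm p)
isPerm? = vecAllPairs? (λ x y → ¬? (x ≟ y))

perms : ∀ r → List (Word r)
perms r = filter isPerm? (words r r)

_∘ₚ_ : ∀ {r} → Word r → Word r → Word r
p ∘ₚ q = tabulate (λ i → lookup p (lookup q i))

findFirst : ∀ {r} → (Fin r → Bool) → Maybe (Fin r)
findFirst {zero}  f = nothing
findFirst {suc r} f with f zero
... | true  = just zero
... | false = Data.Maybe.map suc (findFirst (λ j → f (suc j)))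

inv : ∀ {r} → Word r → Word r
inv p = tabulate (λ i → fromMaybe i (findFirst (λ j → ⌊ lookup p j ≟ i ⌋)))

module GroupRing {c ℓ : Level} (K : CommutativeRing c ℓ) where
  open CommutativeRing K

  Σ[_]_ : ∀ {A : Set} → List A → (A → Carrier) → Carrier
  Σ[ xs ] f = foldr (λ x acc → f x + acc) 0# xs

  -- an element a = Σ_p a(p) p of 𝕂[S_r] is given by its coefficient
  -- function; only its values on permutations matter.
  KS : ℕ → Set c
  KS r = Word r → Carrier

  _≋_ : ∀ {r} → KS r → KS r → Set (ℓ)
  _≋_ {r} a b = ∀ (p : Word r) → IsPerm p → a p ≈ b p

  _·_ : ∀ {r} → KS r → KS r → KS r
  _·_ {r} a b s = Σ[ perms r ] λ p → Σ[ perms r ] λ q →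
    if ⌊ VecP.≡-dec _≟_ (p ∘ₚ q) s ⌋ then a p * b q else 0#

  -- a* = Σ_p a(p) p⁻¹, i.e. a*(p) = a(p⁻¹)
  _* : ∀ {r} → KS r → KS r
  (a *) p = a (inv p)

  IsIdempotent : ∀ {r} → KS r → Set ℓ
  IsIdempotent e = (e · e) ≋ e

  _∈LeftIdealOf_ : ∀ {r} → KS r → KS r → Set (c ⊔ ℓ)
  _∈LeftIdealOf_ {r} x y = Σ (KS r) λ a → x ≋ (a · y)

  -- V = 𝕂ⁿ (every n-dimensional 𝕂-vector space is isomorphic to it)
  V : ℕ → Set c
  V n = Fin n → Carrier

  _+ᵥ_ : ∀ {n} → V n → V n → V n
  (u +ᵥ w) i = u i + w i

  _·ᵥ_ : ∀ {n} → Carrier → V n → V n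
  (x ·ᵥ u) i = x * u i

  set : ∀ {n r} → (Fin r → V n) → Fin r → V n → (Fin r → V n)
  set b i u j = if ⌊ j ≟ i ⌋ then u else b j

  -- r-times covariant tensors: multilinear maps V^r → 𝕂
  Form : ℕ → ℕ → Set c
  Form n r = (Fin r → V n) → Carrier

  record IsTensor {n r : ℕ} (T : Form n r) : Set (c ⊔ ℓ) where
    field
      cong     : ∀ (b b' : Fin r → V n) → (∀ j k → b j k ≈ b' j k) → T b ≈ T b'
      additive : ∀ (b : Fin r → V n) (i : Fin r) (u w : V n) →
                 T (set b i (u +ᵥ w)) ≈ T (set b i u) + T (set b i w)
      homog    : ∀ (b : Fin r → V n) (i : Fin r) (x : Carrier) (u : V n) →
                 T (set b i (x ·ᵥ u)) ≈ x * T (set b i u)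

  _▹_ : ∀ {n r} → KS r → Form n r → Form n r
  _▹_ {n} {r} a T v = Σ[ perms r ] λ p → a p * T (λ i → v (lookup p i))

  _≐_ : ∀ {n r} → Form n r → Form n r → Set (c ⊔ ℓ)
  _≐_ {n} {r} S T = ∀ (v : Fin r → V n) → S v ≈ T v

  _at_ : ∀ {n r} → Form n r → (Fin r → V n) → KS r
  (T at b) p = T (λ i → b (lookup p i))

-- The key identity: for x ∈ 𝕂[S_r] the coefficient of s in T_b · x* is (xT)(b ∘ s).  If eT = T it
-- gives T_b = T_b · e* ∈ 𝕂[S_r]·e*.  Conversely e* is again idempotent, so right multiplication by e*
-- fixes every element of 𝕂[S_r]·e*, and evaluating T_b · e* = T_b at the identity yields (eT)(b) = T(b).
-- The argument works over any commutative ring and for any T that respects equality of its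
-- arguments.
module Submission where

open import Defs
open import Level using (Level; _⊔_)
open import Algebra.Bundles using (CommutativeRing)
open import Data.Nat using (ℕ; zero; suc; _≤_)
open import Data.Nat.Properties using (<-irrefl)
open import Data.Fin using (Fin; zero; suc; _≟_; punchOut)
open import Data.Fin.Properties using (any?; punchOut-injective; injective⇒≤)
open import Data.Vec as Vec using (Vec; []; _∷_; lookup; tabulate; allFin)
open import Data.Vec.Properties
  using (lookup∘tabulate; tabulate∘lookup; tabulate-cong; lookup-allFin; ∷-injective; ≡-dec)
open import Data.Vec.Relation.Unary.Unique.Propositional.Properties
  using (lookup-injective) renaming (tabulate⁺ to tabulate-unique)
open import Data.List as List using (List; []; _∷_; concatMap; cartesianProductWith; _++_)
open import Data.List.Membership.Propositional using (_∈_)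
open import Data.List.Membership.Propositional.Properties
  using (∈-cartesianProductWith⁺; ∈-allFin; ∈-filter⁺; ∈-filter⁻; ∈-map⁺; ∈-map⁻)
open import Data.List.Membership.Propositional.Properties.WithK using (unique∧set⇒bag)
open import Data.List.Relation.Binary.BagAndSetEquality using (∼bag⇒↭)
open import Data.List.Relation.Binary.Permutation.Propositional using (_↭_; ↭⇒↭ₛ′)
open import Data.List.Relation.Binary.Permutation.Propositional.Properties
  using () renaming (map⁺ to ↭-map⁺)
open import Data.List.Properties using (foldr-map)
open import Data.List.Relation.Unary.Any using (here; there)
open import Data.List.Relation.Unary.All as All using ([]; _∷_)
open import Data.List.Relation.Unary.AllPairs using ([]; _∷_)
open import Data.List.Relation.Unary.Unique.Propositional using (Unique)
open import Data.List.Relation.Unary.Unique.Propositional.Properties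
  using (cartesianProductWith⁺; allFin⁺; filter⁺; map⁺)
open import Data.Bool using (Bool; true; false; if_then_else_)
import Data.Bool as Bool
open import Data.Maybe using (just)
import Data.Maybe as Maybe
open import Data.Product using (∃; _×_; _,_; proj₂; swap)
open import Data.Empty using (⊥-elim)
open import Function.Base using (_∘_; flip)
open import Function.Bundles using (_⇔_; mk⇔; Equivalence)
open import Function.Definitions using (Injective)
open import Relation.Nullary using (yes; no)
open import Relation.Unary using (Decidable)
open import Relation.Nullary.Decidable using (⌊_⌋; toWitness; fromWitness)
open import Relation.Binary.PropositionalEquality
  using (_≡_; _≢_; refl; sym; trans; cong; subst; module ≡-Reasoning)

injective⇒surjective : ∀ {n} {f : Fin n → Fin n} → Injective _≡_ _≡_ f → ∀ i → ∃ λ j → f j ≡ i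
injective⇒surjective {suc m} {f} f-inj i with any? (λ j → f j ≟ i)
... | yes hit = hit
... | no miss = ⊥-elim (<-irrefl refl (injective⇒≤ g-inj))
  where
  f≢i : ∀ j → i ≢ f j
  f≢i j i≡fj = miss (j , sym i≡fj)
  g : Fin (suc m) → Fin m
  g j = punchOut (f≢i j)
  g-inj : Injective _≡_ _≡_ g
  g-inj gx≡gy = f-inj (punchOut-injective (f≢i _) (f≢i _) gx≡gy)

findFirst-complete : ∀ {r} (f : Fin r → Bool) j → Bool.T (f j) → ∃ λ k → findFirst f ≡ just k × Bool.T (f k)
findFirst-complete f zero fj with f zero in f0
... | true = zero , refl , subst Bool.T (sym f0) _
findFirst-complete f (suc j) fj with f zero in f0
... | true = zero , refl , subst Bool.T (sym f0) _
... | false with findFirst-complete (f ∘ suc) j fj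
...   | k , found , fk = suc k , cong (Maybe.map suc) found , fk

module _ {r : ℕ} where

  open ≡-Reasoning

  lookup-∘ₚ : ∀ (p q : Word r) i → lookup (p ∘ₚ q) i ≡ lookup p (lookup q i)
  lookup-∘ₚ p q = lookup∘tabulate _

  ≗-lookup⇒≡ : ∀ {p q : Word r} → (∀ i → lookup p i ≡ lookup q i) → p ≡ q
  ≗-lookup⇒≡ {p} {q} p≗q = trans (sym (tabulate∘lookup p)) (trans (tabulate-cong p≗q) (tabulate∘lookup q))

  ∘ₚ-assoc : ∀ (p q s : Word r) → (p ∘ₚ q) ∘ₚ s ≡ p ∘ₚ (q ∘ₚ s)
  ∘ₚ-assoc p q s = ≗-lookup⇒≡ λ i → begin
    lookup ((p ∘ₚ q) ∘ₚ s) i          ≡⟨ lookup-∘ₚ (p ∘ₚ q) s i ⟩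
    lookup (p ∘ₚ q) (lookup s i)      ≡⟨ lookup-∘ₚ p q (lookup s i) ⟩
    lookup p (lookup q (lookup s i))  ≡⟨ cong (lookup p) (lookup-∘ₚ q s i) ⟨
    lookup p (lookup (q ∘ₚ s) i)      ≡⟨ lookup-∘ₚ p (q ∘ₚ s) i ⟨
    lookup (p ∘ₚ (q ∘ₚ s)) i          ∎

  lookup-injective⇒isPerm : ∀ {p : Word r} → Injective _≡_ _≡_ (lookup p) → IsPerm p
  lookup-injective⇒isPerm {p} inj = subst IsPerm (tabulate∘lookup p) (tabulate-unique inj)

  allFin-isPerm : IsPerm (allFin r)
  allFin-isPerm = tabulate-unique (λ i≡j → i≡j)

  ∘ₚ-isPerm : ∀ {p q : Word r} → IsPerm p → IsPerm q → IsPerm (p ∘ₚ q)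
  ∘ₚ-isPerm p-perm q-perm = tabulate-unique λ {i} {j} eq →
    lookup-injective q-perm i j (lookup-injective p-perm _ _ eq)

  -- inv p i is the first preimage of i found by findFirst; it exists since p is onto.
  inv-inverseʳ : ∀ {p : Word r} → IsPerm p → ∀ i → lookup p (lookup (inv p) i) ≡ i
  inv-inverseʳ {p} p-perm i
    with j , pj≡i ← injective⇒surjective (lookup-injective p-perm _ _) i
    with k , found , pk≡i ← findFirst-complete (λ j → ⌊ lookup p j ≟ i ⌋) j (fromWitness pj≡i)
    = trans (cong (lookup p) (trans (lookup∘tabulate _ i) (cong (Maybe.fromMaybe i) found))) (toWitness pk≡i)

  lookup-inv : ∀ {p : Word r} → IsPerm p → ∀ {i j} → lookup p j ≡ i → lookup (inv p) i ≡ j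
  lookup-inv p-perm {i} pj≡i = lookup-injective p-perm _ _ (trans (inv-inverseʳ p-perm i) (sym pj≡i))

  inv-isPerm : ∀ {p : Word r} → IsPerm p → IsPerm (inv p)
  inv-isPerm {p} p-perm = lookup-injective⇒isPerm λ {i} {j} eq →
    trans (sym (inv-inverseʳ p-perm i)) (trans (cong (lookup p) eq) (inv-inverseʳ p-perm j))

  inv-cancelˡ : ∀ {p : Word r} → IsPerm p → ∀ q → inv p ∘ₚ (p ∘ₚ q) ≡ q
  inv-cancelˡ {p} p-perm q = ≗-lookup⇒≡ λ i →
    trans (lookup-∘ₚ (inv p) (p ∘ₚ q) i) (lookup-inv p-perm (sym (lookup-∘ₚ p q i)))

  inv-cancelʳ : ∀ {p : Word r} → IsPerm p → ∀ q → p ∘ₚ (inv p ∘ₚ q) ≡ q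
  inv-cancelʳ {p} p-perm q = ≗-lookup⇒≡ λ i → begin
    lookup (p ∘ₚ (inv p ∘ₚ q)) i      ≡⟨ lookup-∘ₚ p (inv p ∘ₚ q) i ⟩
    lookup p (lookup (inv p ∘ₚ q) i)  ≡⟨ cong (lookup p) (lookup-∘ₚ (inv p) q i) ⟩
    lookup p (lookup (inv p) _)       ≡⟨ inv-inverseʳ p-perm _ ⟩
    lookup q i                        ∎

  inv-involutive : ∀ {p : Word r} → IsPerm p → inv (inv p) ≡ p
  inv-involutive p-perm = ≗-lookup⇒≡ λ i → lookup-inv (inv-isPerm p-perm) (lookup-inv p-perm refl)

  inv-anti-∘ₚ : ∀ {p q : Word r} → IsPerm p → IsPerm q → inv (p ∘ₚ q) ≡ inv q ∘ₚ inv p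
  inv-anti-∘ₚ {p} {q} p-perm q-perm = ≗-lookup⇒≡ λ i → lookup-inv (∘ₚ-isPerm p-perm q-perm) (begin
    lookup (p ∘ₚ q) (lookup q⁻¹p⁻¹ i)  ≡⟨ lookup-∘ₚ (p ∘ₚ q) q⁻¹p⁻¹ i ⟨
    lookup ((p ∘ₚ q) ∘ₚ q⁻¹p⁻¹) i      ≡⟨ cong (λ w → lookup w i) (∘ₚ-assoc p q q⁻¹p⁻¹) ⟩
    lookup (p ∘ₚ (q ∘ₚ q⁻¹p⁻¹)) i      ≡⟨ cong (λ w → lookup (p ∘ₚ w) i) (inv-cancelʳ q-perm (inv p)) ⟩
    lookup (p ∘ₚ inv p) i              ≡⟨ lookup-∘ₚ p (inv p) i ⟩
    lookup p (lookup (inv p) i)        ≡⟨ inv-inverseʳ p-perm i ⟩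
    i                                  ∎)
    where
    q⁻¹p⁻¹ : Word r
    q⁻¹p⁻¹ = inv q ∘ₚ inv p

  inv-anti-inv-∘ₚ : ∀ {p s : Word r} → IsPerm p → IsPerm s → inv (inv p ∘ₚ s) ≡ inv s ∘ₚ p
  inv-anti-inv-∘ₚ {p} {s} p-perm s-perm =
    trans (inv-anti-∘ₚ (inv-isPerm p-perm) s-perm) (cong (inv s ∘ₚ_) (inv-involutive p-perm))

  ∘ₚ≡⇔≡inv-∘ₚ : ∀ {p : Word r} → IsPerm p → ∀ {q s} → (p ∘ₚ q ≡ s) ⇔ (q ≡ inv p ∘ₚ s)
  ∘ₚ≡⇔≡inv-∘ₚ {p} p-perm {q} {s} = mk⇔
    (λ pq≡s → trans (sym (inv-cancelˡ p-perm q)) (cong (inv p ∘ₚ_) pq≡s))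
    (λ q≡p⁻¹s → trans (cong (p ∘ₚ_) q≡p⁻¹s) (inv-cancelʳ p-perm s))

toList∘tabulate : ∀ {A : Set} {n} (f : Fin n → A) → Vec.toList (tabulate f) ≡ List.tabulate f
toList∘tabulate {n = zero}  f = refl
toList∘tabulate {n = suc n} f = cong (f zero ∷_) (toList∘tabulate (f ∘ suc))

concatMap-map≡cartesianProductWith : ∀ {A B C : Set} (f : A → B → C) xs ys →
  concatMap (λ x → List.map (f x) ys) xs ≡ cartesianProductWith f xs ys
concatMap-map≡cartesianProductWith f []       ys = refl
concatMap-map≡cartesianProductWith f (x ∷ xs) ys =
  cong (List.map (f x) ys ++_) (concatMap-map≡cartesianProductWith f xs ys)

module _ {r : ℕ} where

  words-suc : ∀ k → words r (suc k) ≡ cartesianProductWith (flip _∷_) (words r k) (List.allFin r)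
  words-suc k = trans (concatMap-map≡cartesianProductWith (flip _∷_) (words r k) _)
                      (cong (cartesianProductWith (flip _∷_) (words r k)) (toList∘tabulate (λ i → i)))

  words-unique : ∀ k → Unique (words r k)
  words-unique zero    = [] ∷ []
  words-unique (suc k) rewrite words-suc k =
    cartesianProductWith⁺ (flip _∷_) (swap ∘ ∷-injective) (words-unique k) (allFin⁺ r)

  ∈-words : ∀ {k} (w : Vec (Fin r) k) → w ∈ words r k
  ∈-words []      = here refl
  ∈-words {suc k} (i ∷ w) rewrite words-suc k =
    ∈-cartesianProductWith⁺ (flip _∷_) (∈-words w) (∈-allFin i)

  perms-unique : Unique (perms r)
  perms-unique = filter⁺ isPerm? (words-unique r)

  ∈-perms⁺ : ∀ {p : Word r} → IsPerm p → p ∈ perms r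
  ∈-perms⁺ {p} = ∈-filter⁺ isPerm? (∈-words p)

  ∈-perms⁻ : ∀ {p : Word r} → p ∈ perms r → IsPerm p
  ∈-perms⁻ = proj₂ ∘ ∈-filter⁻ isPerm? {xs = words r r}

  ∘ₚ-injectiveʳ : ∀ {q : Word r} → IsPerm q → Injective _≡_ _≡_ (q ∘ₚ_)
  ∘ₚ-injectiveʳ {q} q-perm {u} {v} qu≡qv =
    trans (sym (inv-cancelˡ q-perm u)) (trans (cong (inv q ∘ₚ_) qu≡qv) (inv-cancelˡ q-perm v))

  map-∘ₚ-perms-↭ : ∀ {q : Word r} → IsPerm q → List.map (q ∘ₚ_) (perms r) ↭ perms r
  map-∘ₚ-perms-↭ {q} q-perm = ∼bag⇒↭ (unique∧set⇒bag
    (map⁺ (∘ₚ-injectiveʳ q-perm) perms-unique) perms-unique (mk⇔ image⊆perms perms⊆image))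
    where
    image⊆perms : ∀ {p} → p ∈ List.map (q ∘ₚ_) (perms r) → p ∈ perms r
    image⊆perms p∈image with u , u∈perms , refl ← ∈-map⁻ (q ∘ₚ_) p∈image =
      ∈-perms⁺ (∘ₚ-isPerm q-perm (∈-perms⁻ u∈perms))
    perms⊆image : ∀ {p} → p ∈ perms r → p ∈ List.map (q ∘ₚ_) (perms r)
    perms⊆image {p} p∈perms = subst (_∈ List.map (q ∘ₚ_) (perms r)) (inv-cancelʳ q-perm p)
      (∈-map⁺ (q ∘ₚ_) (∈-perms⁺ (∘ₚ-isPerm (inv-isPerm q-perm) (∈-perms⁻ p∈perms))))

module GroupRingProperties {c ℓ : Level} (K : CommutativeRing c ℓ) where

  open CommutativeRing K renaming (refl to ≈-refl; sym to ≈-sym; trans to ≈-trans)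
  open GroupRing K
  open import Algebra.Properties.CommutativeSemigroup +-commutativeSemigroup using (interchange)
  open import Data.List.Relation.Binary.Permutation.Setoid.Properties setoid using (foldr-commMonoid)
  open import Relation.Binary.Reasoning.Setoid setoid

  private variable
    A B : Set

  Σ-cong : ∀ (xs : List A) {f g : A → Carrier} → (∀ {x} → x ∈ xs → f x ≈ g x) → Σ[ xs ] f ≈ Σ[ xs ] g
  Σ-cong []       f≈g = ≈-refl
  Σ-cong (x ∷ xs) f≈g = +-cong (f≈g (here refl)) (Σ-cong xs (f≈g ∘ there))

  Σ-zero : ∀ (xs : List A) → Σ[ xs ] (λ _ → 0#) ≈ 0#
  Σ-zero []       = ≈-refl
  Σ-zero (x ∷ xs) = ≈-trans (+-congˡ (Σ-zero xs)) (+-identityˡ 0#)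

  Σ-+ : ∀ (xs : List A) (f g : A → Carrier) → Σ[ xs ] (λ x → f x + g x) ≈ Σ[ xs ] f + Σ[ xs ] g
  Σ-+ []       f g = ≈-sym (+-identityˡ 0#)
  Σ-+ (x ∷ xs) f g = ≈-trans (+-congˡ (Σ-+ xs f g)) (interchange _ _ _ _)

  *-distribˡ-Σ : ∀ (xs : List A) a (f : A → Carrier) → a * Σ[ xs ] f ≈ Σ[ xs ] (λ x → a * f x)
  *-distribˡ-Σ []       a f = zeroʳ a
  *-distribˡ-Σ (x ∷ xs) a f = ≈-trans (distribˡ a (f x) _) (+-congˡ (*-distribˡ-Σ xs a f))

  *-distribʳ-Σ : ∀ (xs : List A) a (f : A → Carrier) → Σ[ xs ] f * a ≈ Σ[ xs ] (λ x → f x * a)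
  *-distribʳ-Σ []       a f = zeroˡ a
  *-distribʳ-Σ (x ∷ xs) a f = ≈-trans (distribʳ a (f x) _) (+-congˡ (*-distribʳ-Σ xs a f))

  Σ-comm : (xs : List A) (ys : List B) (f : A → B → Carrier) →
           Σ[ xs ] (λ x → Σ[ ys ] (f x)) ≈ Σ[ ys ] (λ y → Σ[ xs ] (λ x → f x y))
  Σ-comm []       ys f = ≈-sym (Σ-zero ys)
  Σ-comm (x ∷ xs) ys f = ≈-trans (+-congˡ (Σ-comm xs ys f)) (≈-sym (Σ-+ ys (f x) _))

  Σ-map : (φ : B → A) (xs : List B) (f : A → Carrier) → Σ[ List.map φ xs ] f ≡ Σ[ xs ] (f ∘ φ)
  Σ-map φ xs f = foldr-map _ φ 0# xs

  Σ-↭ : ∀ {xs ys : List A} → xs ↭ ys → (f : A → Carrier) → Σ[ xs ] f ≈ Σ[ ys ] f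
  Σ-↭ {xs = xs} {ys} xs↭ys f = begin
    Σ[ xs ] f
      ≡⟨ foldr-map _+_ f 0# xs ⟨
    List.foldr _+_ 0# (List.map f xs)
      ≈⟨ foldr-commMonoid +-isCommutativeMonoid (↭⇒↭ₛ′ isEquivalence (↭-map⁺ f xs↭ys)) ⟩
    List.foldr _+_ 0# (List.map f ys)
      ≡⟨ foldr-map _+_ f 0# ys ⟩
    Σ[ ys ] f
      ∎

  Σ-select : ∀ {xs : List A} {x} {Q : A → Set} (Q? : Decidable Q) (g : A → Carrier) →
             Unique xs → x ∈ xs → (∀ {y} → Q y ⇔ y ≡ x) →
             Σ[ xs ] (λ y → if ⌊ Q? y ⌋ then g y else 0#) ≈ g x
  Σ-select {xs = y ∷ ys} Q? g (y∉ys ∷ ys-unique) (here refl) Q⇔ with Q? y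
  ... | no ¬Qy = ⊥-elim (¬Qy (Equivalence.from Q⇔ refl))
  ... | yes _  = ≈-trans (+-congˡ (≈-trans (Σ-cong ys vanish) (Σ-zero ys))) (+-identityʳ (g y))
    where
    vanish : ∀ {z} → z ∈ ys → (if ⌊ Q? z ⌋ then g z else 0#) ≈ 0#
    vanish {z} z∈ys with Q? z
    ... | yes Qz = ⊥-elim (All.lookup y∉ys z∈ys (sym (Equivalence.to Q⇔ Qz)))
    ... | no _   = ≈-refl
  Σ-select {xs = y ∷ ys} Q? g (y∉ys ∷ ys-unique) (there x∈ys) Q⇔ with Q? y
  ... | yes Qy = ⊥-elim (All.lookup y∉ys (subst (_∈ ys) (sym (Equivalence.to Q⇔ Qy)) x∈ys) refl)
  ... | no _   = ≈-trans (+-identityˡ _) (Σ-select Q? g ys-unique x∈ys Q⇔)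

  module _ {r : ℕ} where

    Σ-translate : ∀ {q : Word r} → IsPerm q → (f : Word r → Carrier) →
                  Σ[ perms r ] (λ p → f (q ∘ₚ p)) ≈ Σ[ perms r ] f
    Σ-translate {q} q-perm f =
      ≈-trans (reflexive (sym (Σ-map (q ∘ₚ_) (perms r) f))) (Σ-↭ (map-∘ₚ-perms-↭ q-perm) f)

    ·-apply : ∀ (x y : KS r) {s} → IsPerm s → (x · y) s ≈ Σ[ perms r ] (λ p → x p * y (inv p ∘ₚ s))
    ·-apply x y {s} s-perm = Σ-cong (perms r) λ {p} p∈perms → let p-perm = ∈-perms⁻ p∈perms in
      Σ-select (λ q → ≡-dec _≟_ (p ∘ₚ q) s) (λ q → x p * y q) perms-unique
        (∈-perms⁺ (∘ₚ-isPerm (inv-isPerm p-perm) s-perm)) (∘ₚ≡⇔≡inv-∘ₚ p-perm)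

    ·-*-apply : ∀ (y x : KS r) {s} → IsPerm s → (y · (x *)) s ≈ Σ[ perms r ] (λ u → y (s ∘ₚ u) * x u)
    ·-*-apply y x {s} s-perm = begin
      (y · (x *)) s
        ≈⟨ ·-apply y (x *) s-perm ⟩
      Σ[ perms r ] (λ p → y p * x (inv (inv p ∘ₚ s)))
        ≈⟨ Σ-cong (perms r) (λ p∈perms →
             *-congˡ (reflexive (cong x (inv-anti-inv-∘ₚ (∈-perms⁻ p∈perms) s-perm)))) ⟩
      Σ[ perms r ] (λ p → y p * x (inv s ∘ₚ p))
        ≈⟨ Σ-translate s-perm (λ p → y p * x (inv s ∘ₚ p)) ⟨
      Σ[ perms r ] (λ u → y (s ∘ₚ u) * x (inv s ∘ₚ (s ∘ₚ u)))
        ≈⟨ Σ-cong (perms r) (λ _ → *-congˡ (reflexive (cong x (inv-cancelˡ s-perm _)))) ⟩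
      Σ[ perms r ] (λ u → y (s ∘ₚ u) * x u)
        ∎

    ≋-refl : ∀ {x : KS r} → x ≋ x
    ≋-refl _ _ = ≈-refl

    ·-cong : ∀ {x x′ y y′ : KS r} → x ≋ x′ → y ≋ y′ → (x · y) ≋ (x′ · y′)
    ·-cong {x} {x′} {y} {y′} x≋x′ y≋y′ s s-perm = begin
      (x · y) s
        ≈⟨ ·-apply x y s-perm ⟩
      Σ[ perms r ] (λ p → x p * y (inv p ∘ₚ s))
        ≈⟨ Σ-cong (perms r) (λ p∈perms → let p-perm = ∈-perms⁻ p∈perms in
             *-cong (x≋x′ _ p-perm) (y≋y′ _ (∘ₚ-isPerm (inv-isPerm p-perm) s-perm))) ⟩
      Σ[ perms r ] (λ p → x′ p * y′ (inv p ∘ₚ s))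
        ≈⟨ ·-apply x′ y′ s-perm ⟨
      (x′ · y′) s
        ∎

    ·-assoc : ∀ (x y z : KS r) → ((x · y) · z) ≋ (x · (y · z))
    ·-assoc x y z s s-perm = begin
      ((x · y) · z) s
        ≈⟨ ·-apply (x · y) z s-perm ⟩
      Σ[ perms r ] (λ p → (x · y) p * z (inv p ∘ₚ s))
        ≈⟨ Σ-cong (perms r) (λ p∈perms → *-congʳ (·-apply x y (∈-perms⁻ p∈perms))) ⟩
      Σ[ perms r ] (λ p → Σ[ perms r ] (λ q → x q * y (inv q ∘ₚ p)) * z (inv p ∘ₚ s))
        ≈⟨ Σ-cong (perms r) (λ _ → *-distribʳ-Σ (perms r) _ _) ⟩
      Σ[ perms r ] (λ p → Σ[ perms r ] (λ q → x q * y (inv q ∘ₚ p) * z (inv p ∘ₚ s)))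
        ≈⟨ Σ-comm (perms r) (perms r) _ ⟩
      Σ[ perms r ] (λ q → Σ[ perms r ] (λ p → x q * y (inv q ∘ₚ p) * z (inv p ∘ₚ s)))
        ≈⟨ Σ-cong (perms r) (λ q∈perms → inner (∈-perms⁻ q∈perms)) ⟩
      Σ[ perms r ] (λ q → x q * (y · z) (inv q ∘ₚ s))
        ≈⟨ ·-apply x (y · z) s-perm ⟨
      (x · (y · z)) s
        ∎
      where
      inner : ∀ {q} → IsPerm q →
              Σ[ perms r ] (λ p → x q * y (inv q ∘ₚ p) * z (inv p ∘ₚ s)) ≈ x q * (y · z) (inv q ∘ₚ s)
      inner {q} q-perm = begin
        Σ[ perms r ] (λ p → x q * y (inv q ∘ₚ p) * z (inv p ∘ₚ s))
          ≈⟨ Σ-translate q-perm (λ p → x q * y (inv q ∘ₚ p) * z (inv p ∘ₚ s)) ⟨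
        Σ[ perms r ] (λ u → x q * y (inv q ∘ₚ (q ∘ₚ u)) * z (inv (q ∘ₚ u) ∘ₚ s))
          ≈⟨ Σ-cong (perms r) (λ u∈perms → ≈-trans (*-assoc _ _ _) (*-congˡ (*-cong
               (reflexive (cong y (inv-cancelˡ q-perm _))) (reflexive (cong z (regroup (∈-perms⁻ u∈perms))))))) ⟩
        Σ[ perms r ] (λ u → x q * (y u * z (inv u ∘ₚ (inv q ∘ₚ s))))
          ≈⟨ *-distribˡ-Σ (perms r) (x q) _ ⟨
        x q * Σ[ perms r ] (λ u → y u * z (inv u ∘ₚ (inv q ∘ₚ s)))
          ≈⟨ *-congˡ (·-apply y z (∘ₚ-isPerm (inv-isPerm q-perm) s-perm)) ⟨
        x q * (y · z) (inv q ∘ₚ s)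
          ∎
        where
        regroup : ∀ {u} → IsPerm u → inv (q ∘ₚ u) ∘ₚ s ≡ inv u ∘ₚ (inv q ∘ₚ s)
        regroup {u} u-perm = trans (cong (_∘ₚ s) (inv-anti-∘ₚ q-perm u-perm)) (∘ₚ-assoc (inv u) (inv q) s)

    *-anti-· : ∀ (x y : KS r) → ((x · y) *) ≋ ((y *) · (x *))
    *-anti-· x y s s-perm = begin
      (x · y) (inv s)
        ≈⟨ ·-apply x y (inv-isPerm s-perm) ⟩
      Σ[ perms r ] (λ q → x q * y (inv q ∘ₚ inv s))
        ≈⟨ Σ-cong (perms r) (λ q∈perms → ≈-trans (*-comm _ _)
             (*-congʳ (reflexive (cong y (sym (inv-anti-∘ₚ s-perm (∈-perms⁻ q∈perms))))))) ⟩
      Σ[ perms r ] (λ q → y (inv (s ∘ₚ q)) * x q)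
        ≈⟨ ·-*-apply (y *) x s-perm ⟨
      ((y *) · (x *)) s
        ∎

    *-idempotent : ∀ {e : KS r} → IsIdempotent e → IsIdempotent (e *)
    *-idempotent {e} e-idem s s-perm = ≈-trans (≈-sym (*-anti-· e e s s-perm)) (e-idem (inv s) (inv-isPerm s-perm))

    ∈LeftIdealOf⇒·-fixed : ∀ {x f : KS r} → IsIdempotent f → x ∈LeftIdealOf f → (x · f) ≋ x
    ∈LeftIdealOf⇒·-fixed {x} {f} f-idem (a , x≋af) s s-perm = begin
      (x · f) s        ≈⟨ ·-cong x≋af ≋-refl s s-perm ⟩
      ((a · f) · f) s  ≈⟨ ·-assoc a f f s s-perm ⟩
      (a · (f · f)) s  ≈⟨ ·-cong ≋-refl f-idem s s-perm ⟩
      (a · f) s        ≈⟨ x≋af s s-perm ⟨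
      x s              ∎

    module _ {n : ℕ} where

      Extensional : Form n r → Set (c ⊔ ℓ)
      Extensional T = ∀ {b b′ : Fin r → V n} → (∀ i → b i ≡ b′ i) → T b ≈ T b′

      IsTensor⇒Extensional : ∀ {T : Form n r} → IsTensor T → Extensional T
      IsTensor⇒Extensional T-tensor b≗b′ =
        IsTensor.cong T-tensor _ _ (λ j k → reflexive (cong (λ u → u k) (b≗b′ j)))

      ▹-extensional : ∀ (x : KS r) {T : Form n r} → Extensional T → Extensional (x ▹ T)
      ▹-extensional x T-ext b≗b′ = Σ-cong (perms r) (λ {p} _ → *-congˡ (T-ext (λ i → b≗b′ (lookup p i))))

      at-·-* : ∀ (x : KS r) {T : Form n r} → Extensional T → ∀ b {s} → IsPerm s →
               ((T at b) · (x *)) s ≈ (x ▹ T) (λ i → b (lookup s i))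
      at-·-* x {T} T-ext b {s} s-perm = begin
        ((T at b) · (x *)) s
          ≈⟨ ·-*-apply (T at b) x s-perm ⟩
        Σ[ perms r ] (λ u → T (λ i → b (lookup (s ∘ₚ u) i)) * x u)
          ≈⟨ Σ-cong (perms r) (λ {u} _ →
               ≈-trans (*-comm _ _) (*-congˡ (T-ext (λ i → cong b (lookup-∘ₚ s u i))))) ⟩
        (x ▹ T) (λ i → b (lookup s i))
          ∎

      ▹-fixed⇒at-∈LeftIdealOf : ∀ (e : KS r) {T : Form n r} → Extensional T →
                                (e ▹ T) ≐ T → ∀ b → (T at b) ∈LeftIdealOf (e *)
      ▹-fixed⇒at-∈LeftIdealOf e {T} T-ext eT≐T b =
        T at b , λ s s-perm → ≈-sym (≈-trans (at-·-* e T-ext b s-perm) (eT≐T _))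

      at-∈LeftIdealOf⇒▹-fixed : ∀ {e : KS r} → IsIdempotent e → ∀ {T : Form n r} → Extensional T →
                                (∀ b → (T at b) ∈LeftIdealOf (e *)) → (e ▹ T) ≐ T
      at-∈LeftIdealOf⇒▹-fixed {e} e-idem {T} T-ext T-in v = begin
        (e ▹ T) v
          ≈⟨ ▹-extensional e T-ext (λ i → cong v (sym (lookup-allFin i))) ⟩
        (e ▹ T) (λ i → v (lookup (allFin r) i))
          ≈⟨ at-·-* e T-ext v allFin-isPerm ⟨
        ((T at v) · (e *)) (allFin r)
          ≈⟨ ∈LeftIdealOf⇒·-fixed (*-idempotent e-idem) (T-in v) _ allFin-isPerm ⟩
        (T at v) (allFin r)
          ≈⟨ T-ext (λ i → cong v (lookup-allFin i)) ⟩
        T v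
          ∎

proposition2p4 : ∀ {c ℓ : Level} (K : CommutativeRing c ℓ) → IsCharZeroField K →
    let open GroupRing K in
    (n r : ℕ) → 1 ≤ r →
    (e : KS r) → IsIdempotent e →
    (T : Form n r) → IsTensor T →
    ((e ▹ T) ≐ T) ⇔ (∀ (b : Fin r → V n) → (T at b) ∈LeftIdealOf (e *))
proposition2p4 K _ n r _ e e-idem T T-tensor =
  mk⇔ (▹-fixed⇒at-∈LeftIdealOf e (IsTensor⇒Extensional T-tensor))
      (at-∈LeftIdealOf⇒▹-fixed e-idem (IsTensor⇒Extensional T-tensor))
  where open GroupRingProperties K
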